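{- A hybrid logic formula $\phi$ is valid (true at every world of every model) if and only if the disjunctive state consisting of the single game state $\mathbf{P}:\phi$ is winning, i.e. there is a regulation function $\rho$ such that I have a winning strategy for $\mathbf{DG}(\mathbf{P}:\phi,\rho)$.
   Context: Language: disjoint countably infinite sets $N$ (nominals) and $P$ (propositional variables); formulas $\phi ::= p \mid i \mid R(i,j) \mid \phi\wedge\phi \mid \phi\vee\phi \mid \phi\rightarrow\phi \mid \neg\phi \mid @_i\phi \mid \Box\phi \mid \Diamond\phi$; $p$, $i$, $R(i,j)$ are elementary. A model $\mathcal{M}=(\mathsf{W},\mathsf{R},\mathsf{V},\mathsf{g})$ ($\mathsf{W}\ne\emptyset$, $\mathsf{R}\subseteq\mathsf{W}^2$, $\mathsf{V}:P\to\mathcal{P}(\mathsf{W})$, $\mathsf{g}:N\to\mathsf{W}$) is named if $\mathsf{g}$ is surjective. Truth is standard hybrid-logic semantics ($\mathcal{M},\mathsf{w}\models i$ iff $\mathsf{g}(i)=\mathsf{w}$; $\models R(i,j)$ iff $\mathsf{g}(i)\mathsf{R}\mathsf{g}(j)$; $\models @_i\phi$ iff $\mathcal{M},\mathsf{g}(i)\models\phi$; $\Box,\Diamond$ quantify over $\mathsf{R}$-successors). $\phi$ is valid if $\mathcal{M},\mathsf{w}\models\phi$ for all models $\mathcal{M}$ and all worlds $\mathsf{w}$. Semantic game over a named model $\mathcal{M}$ (players Me (I) and You). Game states: $\mathbf{Q},i:\phi$ (the claim at world $\mathsf{g}(i)$) or $\mathbf{Q}:\phi$, with $\mathbf{Q}\in\{\mathbf{P},\mathbf{O}\}$.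 The tree $\mathbf{G}(\mathcal{M},g)$, nodes labelled I or Y, is defined by these rules for $\mathbf{P}$-states; for $\mathbf{O}$-states swap I/Y and $\mathbf{P}$/$\mathbf{O}$ in the rule. $\mathbf{P},i:\psi_1\vee\psi_2$: labelled I, children $\mathbf{G}(\mathbf{P},i:\psi_1)$, $\mathbf{G}(\mathbf{P},i:\psi_2)$. $\mathbf{P},i:\psi_1\wedge\psi_2$: labelled Y, same children. $\mathbf{P},i:\psi_1\rightarrow\psi_2$: labelled I, children $\mathbf{G}(\mathbf{O},i:\psi_1)$, $\mathbf{G}(\mathbf{P},i:\psi_2)$. $\mathbf{P},i:\neg\psi$: labelled I, child $\mathbf{G}(\mathbf{O},i:\psi)$. $\mathbf{P},i:@_j\psi$: labelled I, child $\mathbf{G}(\mathbf{P},j:\psi)$. $\mathbf{P},i:\Box\psi$: labelled Y, children $\mathbf{G}(\mathbf{P},j:\neg R(i,j)\vee\psi)$ for all $j\in N$. $\mathbf{P},i:\Diamond\psi$: labelled I, children $\mathbf{G}(\mathbf{P},j:R(i,j)\wedge\psi)$ for all $j\in N$. $\mathbf{P}:\psi$: labelled Y, children $\mathbf{G}(\mathbf{P},i:\psi)$ for all $i\in N$. Leaves: $\mathbf{P},i:\phi$ with $\phi$ elementary is a leaf labelled I iff $\mathcal{M},\mathsf{g}(i)\models\phi$ (and $\mathbf{O},i:\phi$ labelled I iff $\mathcal{M},\mathsf{g}(i)\not\models\phi$). I choose at I-nodes, You at Y-nodes. A strategy for Me keeps exactly one child at each non-leaf I-node; it is winning if all leaves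 are labelled I. A game state is elementary if it is $\mathbf{Q},i:\phi$ with $\phi$ elementary. Disjunctive game. A disjunctive state is a finite nonempty multiset of game states, written $g_1\bigvee\dots\bigvee g_n$; it is elementary if all its game states are elementary, and game valid if for every named model $\mathcal{M}$ some $g_k$ admits a winning strategy for Me in $\mathbf{G}(\mathcal{M},g_k)$. A regulation function $\rho$ maps each non-elementary disjunctive state to one of its non-elementary game states. The tree $\mathbf{DG}(D,\rho)$: if $\rho(D'\bigvee g)=g$ and $g$ is labelled Y, then $D'\bigvee g$ is labelled Y with children $\mathbf{DG}(D'\bigvee g',\rho)$ for all children $g'$ of $g$ in $\mathbf{G}(g)$; if $g$ is labelled I, then $D'\bigvee g$ is labelled I with those children plus $\mathbf{DG}(D'\bigvee g\bigvee g,\rho)$ (duplication); an elementary disjunctive state is a leaf labelled I if game valid, Y otherwise. A strategy for Me keeps exactly one child at each non-leaf I-node; it is winning if every branch is finite and ends in a leaf labelled I. $D$ is winning if for some $\rho$ I have a winning strategy for $\mathbf{DG}(D,\rho)$. -}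

module Defs where

open import Data.Nat using (ℕ)
open import Data.Bool using (Bool; true; false; if_then_else_)
open import Data.Unit using (⊤)
open import Data.Empty using (⊥)
open import Data.Product using (Σ; ∃; _×_; _,_)
open import Data.Sum using (_⊎_)
open import Data.List using (List; []; _∷_)
open import Data.List.Relation.Unary.Any as Any using (Any; _─_)
open import Data.List.Relation.Unary.All using (All)
open import Data.List.Relation.Binary.Permutation.Propositional using (_↭_)
open import Relation.Binary.PropositionalEquality using (_≡_)

-- Syntax. Nominals N and propositional variables P are both copies of ℕ
-- (countably infinite; disjoint because they are used in different
-- constructors).

Nom : Set
Nom = ℕ

PVar : Set
PVar = ℕ

infixr 6 _∧'_
infixr 5 _∨'_
infixr 4 _⇒'_

data Form : Set where
  var   : PVar → Form
  nom   : Nom → Form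
  rel   : Nom → Nom → Form
  _∧'_  : Form → Form → Form
  _∨'_  : Form → Form → Form
  _⇒'_  : Form → Form → Form
  ¬'_   : Form → Form
  at'   : Nom → Form → Form
  □'_   : Form → Form
  ◇'_   : Form → Form

isElemForm : Form → Bool
isElemForm (var _)   = true
isElemForm (nom _)   = true
isElemForm (rel _ _) = true
isElemForm _         = false

record Model : Set₁ where
  field
    W : Set
    R : W → W → Set
    V : PVar → W → Set
    g : Nom → W

open Model public

Named : Model → Set
Named M = ∀ (w : W M) → ∃ λ i → g M i ≡ w

_,_⊨_ : (M : Model) → W M → Form → Set
M , w ⊨ var p   = V M p w
M , w ⊨ nom i   = g M i ≡ w
M , w ⊨ rel i j = R M (g M i) (g M j)
M , w ⊨ (φ ∧' ψ) = (M , w ⊨ φ) × (M , w ⊨ ψ)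
M , w ⊨ (φ ∨' ψ) = (M , w ⊨ φ) ⊎ (M , w ⊨ ψ)
M , w ⊨ (φ ⇒' ψ) = (M , w ⊨ φ) → (M , w ⊨ ψ)
M , w ⊨ (¬' φ)   = (M , w ⊨ φ) → ⊥
M , w ⊨ at' i φ  = M , g M i ⊨ φ
M , w ⊨ (□' φ)   = ∀ (v : W M) → R M w v → M , v ⊨ φ
M , w ⊨ (◇' φ)   = Σ (W M) λ v → R M w v × (M , v ⊨ φ)

Valid : Form → Set₁
Valid φ = ∀ (M : Model) (w : W M) → M , w ⊨ φ

data Pol : Set where
  𝐏 𝐎 : Pol

flipPol : Pol → Pol
flipPol 𝐏 = 𝐎
flipPol 𝐎 = 𝐏

data Player : Set where
  Me You : Player

swapPl : Player → Player
swapPl Me  = You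
swapPl You = Me

-- the label given by the P-rule, swapped for O-states
own : Pol → Player → Player
own 𝐏 x = x
own 𝐎 x = swapPl x

data GState : Set where
  at   : Pol → Nom → Form → GState
  glob : Pol → Form → GState

isElem : GState → Bool
isElem (at _ _ φ) = isElemForm φ
isElem (glob _ _) = false

ElemS NonElem : GState → Set
ElemS s   = isElem s ≡ true
NonElem s = isElem s ≡ false

-- label of a non-leaf node (dummy value on leaves)
owner : GState → Player
owner (glob Q φ)       = own Q You
owner (at Q i (φ ∧' ψ)) = own Q You
owner (at Q i (φ ∨' ψ)) = own Q Me
owner (at Q i (φ ⇒' ψ)) = own Q Me
owner (at Q i (¬' φ))   = own Q Me
owner (at Q i (at' j φ)) = own Q Me
owner (at Q i (□' φ))   = own Q You
owner (at Q i (◇' φ))   = own Q Me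
owner (at Q i _)        = Me

Ix : GState → Set
Ix (glob Q φ)        = Nom
Ix (at Q i (φ ∧' ψ))  = Bool
Ix (at Q i (φ ∨' ψ))  = Bool
Ix (at Q i (φ ⇒' ψ))  = Bool
Ix (at Q i (¬' φ))    = ⊤
Ix (at Q i (at' j φ)) = ⊤
Ix (at Q i (□' φ))    = Nom
Ix (at Q i (◇' φ))    = Nom
Ix (at Q i _)         = ⊥

child : (s : GState) → Ix s → GState
child (glob Q φ)        i = at Q i φ
child (at Q i (φ ∧' ψ))  b = if b then at Q i φ else at Q i ψ
child (at Q i (φ ∨' ψ))  b = if b then at Q i φ else at Q i ψ
child (at Q i (φ ⇒' ψ))  b = if b then at (flipPol Q) i φ else at Q i ψ
child (at Q i (¬' φ))    _ = at (flipPol Q) i φ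
child (at Q i (at' j φ)) _ = at Q j φ
child (at Q i (□' φ))    j = at Q j ((¬' rel i j) ∨' φ)
child (at Q i (◇' φ))    j = at Q j (rel i j ∧' φ)

LeafI : Model → Pol → Nom → Form → Set
LeafI M 𝐏 i φ = M , g M i ⊨ φ
LeafI M 𝐎 i φ = (M , g M i ⊨ φ) → ⊥

-- WinG M s : the type of winning strategies for Me in G(M,s)
-- (subtrees keeping one child at I-nodes, all children at Y-nodes,
--  all leaves labelled I; the game tree is well-founded)
data WinG (M : Model) : GState → Set where
  leafW : ∀ {Q i φ} → isElemForm φ ≡ true → LeafI M Q i φ → WinG M (at Q i φ)
  pickI : ∀ {s} → NonElem s → owner s ≡ Me → (x : Ix s) →
          WinG M (child s x) → WinG M s
  allY  : ∀ {s} → NonElem s → owner s ≡ You →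
          (∀ (x : Ix s) → WinG M (child s x)) → WinG M s

-- Disjunctive game. A disjunctive state is a finite nonempty multiset,
-- represented by a list (taken up to permutation _↭_).

DState : Set
DState = List GState

GameValid : DState → Set₁
GameValid D = ∀ (M : Model) → Named M → Any (WinG M) D

-- regulation function: picks (an occurrence of) a non-elementary game
-- state of each non-elementary disjunctive state; as a function on
-- multisets it must be invariant under permutation.
record Regulation : Set where
  field
    pick : (D : DState) → Any NonElem D → Any NonElem D
    invariant : ∀ {D D'} (n : Any NonElem D) (n' : Any NonElem D') → D ↭ D' →
                Any.lookup (pick D n) ≡ Any.lookup (pick D' n')

open Regulation public

-- DWin ρ D : the type of winning strategies for Me in DG(D,ρ)
-- (inductive, so every branch is finite and ends in a leaf labelled I)
data DWin (ρ : Regulation) : DState → Set₁ where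
  leafD : ∀ {D} → All ElemS D → GameValid D → DWin ρ D
  stepY : ∀ {D} (n : Any NonElem D) →
          owner (Any.lookup (pick ρ D n)) ≡ You →
          (∀ (x : Ix (Any.lookup (pick ρ D n))) →
             DWin ρ (child (Any.lookup (pick ρ D n)) x ∷ (D ─ pick ρ D n))) →
          DWin ρ D
  stepI : ∀ {D} (n : Any NonElem D) →
          owner (Any.lookup (pick ρ D n)) ≡ Me →
          (x : Ix (Any.lookup (pick ρ D n))) →
          DWin ρ (child (Any.lookup (pick ρ D n)) x ∷ (D ─ pick ρ D n)) →
          DWin ρ D
  dupI  : ∀ {D} (n : Any NonElem D) →
          owner (Any.lookup (pick ρ D n)) ≡ Me →
          DWin ρ (Any.lookup (pick ρ D n) ∷ Any.lookup (pick ρ D n) ∷ (D ─ pick ρ D n)) →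
          DWin ρ D

Winning : DState → Set₁
Winning D = Σ Regulation λ ρ → DWin ρ D

{-# OPTIONS --safe #-}

-- Soundness: against a countermodel, You can answer a winning strategy of mine so that every
-- game state of the disjunction stays refuted; when You has to pick a witness world, a fresh
-- nominal is reassigned to it. At an elementary leaf, identifying nominals denoting the
-- same world gives a named model refuting the whole leaf, contradicting its game validity.
--
-- Completeness: fix a regulation that serves You's states first and otherwise the state with
-- the fewest copies (ties broken by a coding). From a disjunctive state that is not winning
-- there is an infinite play through non-winning states in which You's moves lose and I,
-- steering the regulation by duplication, eventually make every choice of every one of my
-- states. Reading equality of nominals, R and V off the elementary claims made against me
-- along this play gives a named model refuting every state occurring in it, in particular P:φ.

module Submission where

open import Axiom.DoubleNegationElimination using (em⇒dne)
open import Axiom.ExcludedMiddle using (ExcludedMiddle)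
open import Data.Bool using (true; false)
import Data.Bool.Properties as Bool
open import Data.Empty using (⊥-elim)
open import Data.List using (List; []; _∷_; map; filter)
open import Data.List.Extrema.Nat using (argmin; argmin-all; f[argmin]≤f[xs])
open import Data.List.Membership.Propositional using (_∈_; find; lose)
open import Data.List.Membership.Propositional.Properties using (∈-lookup; ∈-filter⁺; ∈-filter⁻)
open import Data.List.Relation.Binary.Permutation.Propositional
  using (_↭_; ↭-refl; ↭-prep; ↭-swap; ↭-trans; ↭-sym)
open import Data.List.Relation.Binary.Permutation.Propositional.Properties
  using (map⁺; ∈-resp-↭; Any-resp-↭; All-resp-↭)
open import Data.List.Relation.Binary.Subset.Propositional using (_⊆_)
open import Data.List.Relation.Binary.Subset.Propositional.Properties using (Any-resp-⊆)
open import Data.List.Relation.Unary.All as All using (All; []; _∷_)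
open import Data.List.Relation.Unary.Any as Any using (Any; here; there; _─_)
open import Data.List.Relation.Unary.Any.Properties using (lookup-result)
open import Data.Nat as ℕ using (ℕ; zero; suc; _+_; _∸_; _⊔_; _≤_; _<_; z≤n; s≤s)
open import Data.Nat.Induction using (<-wellFounded)
open import Data.Nat.ListAction using (sum)
open import Data.Nat.ListAction.Properties using (sum-↭)
open import Data.Nat.Properties as ℕ using (≤-refl; ≤-trans; <-≤-trans; m≤m+n; m≤n+m; m≤m⊔n; m≤n⊔m)
open import Data.Product as Product using (Σ; ∃; ∃₂; _×_; _,_; proj₁; proj₂; uncurry)
open import Data.Product.Function.NonDependent.Propositional using (_×-⇔_)
open import Data.Sum as Sum using (_⊎_; inj₁; inj₂; [_,_]′)
open import Data.Sum.Function.Propositional using (_⊎-⇔_)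
open import Data.Unit using (tt)
open import Function using (_∘_; id; const)
open import Function.Bundles using (_⇔_; mk⇔; Equivalence)
open import Function.Related.TypeIsomorphisms using (→-cong-⇔; ¬-cong-⇔)
open import Induction.WellFounded using (Acc; acc)
open import Level using (0ℓ)
open import Relation.Binary.Core using (Rel)
open import Relation.Binary.Definitions using (DecidableEquality)
import Relation.Binary.Construct.On as On
open import Relation.Binary.PropositionalEquality hiding ([_])
open import Relation.Binary.Structures using (IsEquivalence)
open import Relation.Nullary using (Dec; yes; no; ¬_)
open import Relation.Nullary.Decidable using (map′; _×-dec_; _→-dec_)
open import Relation.Unary as U using (Pred)

open import Defs

-- Coding game states by natural numbers

triangle : ℕ → ℕ
triangle zero    = zero
triangle (suc n) = suc n + triangle n

pair : ℕ → ℕ → ℕ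
pair a b = triangle (a + b) + a

unpair : ℕ → ℕ × ℕ
unpair zero = 0 , 0
unpair (suc n) with unpair n
... | a , zero  = 0 , suc a
... | a , suc b = suc a , b

unpair-triangle : ∀ d a → a ≤ d → unpair (triangle d + a) ≡ (a , d ∸ a)
unpair-triangle zero    zero    z≤n = refl
unpair-triangle (suc d) zero    z≤n
  rewrite ℕ.+-identityʳ (d + triangle d) | ℕ.+-comm d (triangle d)
        | unpair-triangle d d ≤-refl | ℕ.n∸n≡0 d = refl
unpair-triangle d       (suc a) a<d
  rewrite ℕ.+-suc (triangle d) a | unpair-triangle d a (ℕ.<⇒≤ a<d) | ℕ.+-∸-assoc 1 a<d = refl

unpair-pair : ∀ a b → unpair (pair a b) ≡ (a , b)
unpair-pair a b rewrite unpair-triangle (a + b) a (m≤m+n a b) | ℕ.m+n∸m≡n a b = refl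

pair-injective : ∀ {a b c d} → pair a b ≡ pair c d → a ≡ c × b ≡ d
pair-injective {a} {b} {c} {d} eq
  with trans (sym (unpair-pair a b)) (trans (cong unpair eq) (unpair-pair c d))
... | refl = refl , refl

n≤triangle : ∀ n → n ≤ triangle n
n≤triangle zero    = z≤n
n≤triangle (suc n) = m≤m+n (suc n) (triangle n)

triangle-mono-≤ : ∀ {m n} → m ≤ n → triangle m ≤ triangle n
triangle-mono-≤ z≤n       = z≤n
triangle-mono-≤ (s≤s m≤n) = s≤s (ℕ.+-mono-≤ m≤n (triangle-mono-≤ m≤n))

m≤pair : ∀ a b → a ≤ pair a b
m≤pair a b = m≤n+m a (triangle (a + b))

n≤pair : ∀ a b → b ≤ pair a b
n≤pair a b = ≤-trans (m≤n+m b a) (≤-trans (n≤triangle (a + b)) (m≤m+n _ a))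

pair-monoˡ-≤ : ∀ {a a′} b → a ≤ a′ → pair a b ≤ pair a′ b
pair-monoˡ-≤ b a≤a′ = ℕ.+-mono-≤ (triangle-mono-≤ (ℕ.+-monoˡ-≤ b a≤a′)) a≤a′

encodeForm : Form → ℕ
encodeForm (var p)   = pair 0 p
encodeForm (nom i)   = pair 1 i
encodeForm (rel i j) = pair 2 (pair i j)
encodeForm (φ ∧' ψ)  = pair 3 (pair (encodeForm φ) (encodeForm ψ))
encodeForm (φ ∨' ψ)  = pair 4 (pair (encodeForm φ) (encodeForm ψ))
encodeForm (φ ⇒' ψ)  = pair 5 (pair (encodeForm φ) (encodeForm ψ))
encodeForm (¬' φ)    = pair 6 (encodeForm φ)
encodeForm (at' i φ) = pair 7 (pair i (encodeForm φ))
encodeForm (□' φ)    = pair 8 (encodeForm φ)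
encodeForm (◇' φ)    = pair 9 (encodeForm φ)

depth : Form → ℕ
depth (φ ∧' ψ)  = suc (depth φ ⊔ depth ψ)
depth (φ ∨' ψ)  = suc (depth φ ⊔ depth ψ)
depth (φ ⇒' ψ)  = suc (depth φ ⊔ depth ψ)
depth (¬' φ)    = suc (depth φ)
depth (at' i φ) = suc (depth φ)
depth (□' φ)    = suc (depth φ)
depth (◇' φ)    = suc (depth φ)
depth _         = zero

decodeNode : ℕ → ℕ → (ℕ → Form) → Form
decodeNode 0 n d = var n
decodeNode 1 n d = nom n
decodeNode 2 n d = uncurry rel (unpair n)
decodeNode 3 n d = uncurry (λ a b → d a ∧' d b) (unpair n)
decodeNode 4 n d = uncurry (λ a b → d a ∨' d b) (unpair n)
decodeNode 5 n d = uncurry (λ a b → d a ⇒' d b) (unpair n)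
decodeNode 6 n d = ¬' d n
decodeNode 7 n d = uncurry (λ i a → at' i (d a)) (unpair n)
decodeNode 8 n d = □' d n
decodeNode 9 n d = ◇' d n
decodeNode _ n d = var 0

-- The first argument is fuel: a bound on the depth of the formula to decode.
decodeForm : ℕ → ℕ → Form
decodeForm fuel n = uncurry (λ tag m → decodeNode tag m (subformula fuel)) (unpair n)
  where
  subformula : ℕ → ℕ → Form
  subformula zero    = λ _ → var 0
  subformula (suc f) = decodeForm f

decodeForm-encodeForm : ∀ φ {f} → depth φ ≤ f → decodeForm f (encodeForm φ) ≡ φ
decodeForm-encodeForm (var p)   _ rewrite unpair-pair 0 p = refl
decodeForm-encodeForm (nom i)   _ rewrite unpair-pair 1 i = refl
decodeForm-encodeForm (rel i j) _ rewrite unpair-pair 2 (pair i j) | unpair-pair i j = refl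
decodeForm-encodeForm (φ ∧' ψ) {suc f} (s≤s d≤f)
  rewrite unpair-pair 3 (pair (encodeForm φ) (encodeForm ψ)) | unpair-pair (encodeForm φ) (encodeForm ψ)
        | decodeForm-encodeForm φ (≤-trans (m≤m⊔n _ _) d≤f) | decodeForm-encodeForm ψ (≤-trans (m≤n⊔m _ _) d≤f) = refl
decodeForm-encodeForm (φ ∨' ψ) {suc f} (s≤s d≤f)
  rewrite unpair-pair 4 (pair (encodeForm φ) (encodeForm ψ)) | unpair-pair (encodeForm φ) (encodeForm ψ)
        | decodeForm-encodeForm φ (≤-trans (m≤m⊔n _ _) d≤f) | decodeForm-encodeForm ψ (≤-trans (m≤n⊔m _ _) d≤f) = refl
decodeForm-encodeForm (φ ⇒' ψ) {suc f} (s≤s d≤f)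
  rewrite unpair-pair 5 (pair (encodeForm φ) (encodeForm ψ)) | unpair-pair (encodeForm φ) (encodeForm ψ)
        | decodeForm-encodeForm φ (≤-trans (m≤m⊔n _ _) d≤f) | decodeForm-encodeForm ψ (≤-trans (m≤n⊔m _ _) d≤f) = refl
decodeForm-encodeForm (¬' φ) {suc f} (s≤s d≤f)
  rewrite unpair-pair 6 (encodeForm φ) | decodeForm-encodeForm φ d≤f = refl
decodeForm-encodeForm (at' i φ) {suc f} (s≤s d≤f)
  rewrite unpair-pair 7 (pair i (encodeForm φ)) | unpair-pair i (encodeForm φ) | decodeForm-encodeForm φ d≤f = refl
decodeForm-encodeForm (□' φ) {suc f} (s≤s d≤f)
  rewrite unpair-pair 8 (encodeForm φ) | decodeForm-encodeForm φ d≤f = refl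
decodeForm-encodeForm (◇' φ) {suc f} (s≤s d≤f)
  rewrite unpair-pair 9 (encodeForm φ) | decodeForm-encodeForm φ d≤f = refl

encodeWithDepth : Form → ℕ
encodeWithDepth φ = pair (depth φ) (encodeForm φ)

decodeWithDepth : ℕ → Form
decodeWithDepth = uncurry decodeForm ∘ unpair

decodeWithDepth-encode : ∀ φ → decodeWithDepth (encodeWithDepth φ) ≡ φ
decodeWithDepth-encode φ rewrite unpair-pair (depth φ) (encodeForm φ) = decodeForm-encodeForm φ ≤-refl

encode : GState → ℕ
encode (at 𝐏 i φ)  = pair 0 (pair i (encodeWithDepth φ))
encode (at 𝐎 i φ)  = pair 1 (pair i (encodeWithDepth φ))
encode (glob 𝐏 φ) = pair 2 (encodeWithDepth φ)
encode (glob 𝐎 φ) = pair 3 (encodeWithDepth φ)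

decode : ℕ → GState
decode = uncurry node ∘ unpair
  where
  node : ℕ → ℕ → GState
  node 0 n = uncurry (λ i c → at 𝐏 i (decodeWithDepth c)) (unpair n)
  node 1 n = uncurry (λ i c → at 𝐎 i (decodeWithDepth c)) (unpair n)
  node 2 n = glob 𝐏 (decodeWithDepth n)
  node _ n = glob 𝐎 (decodeWithDepth n)

decode-encode : ∀ s → decode (encode s) ≡ s
decode-encode (at 𝐏 i φ)
  rewrite unpair-pair 0 (pair i (encodeWithDepth φ)) | unpair-pair i (encodeWithDepth φ)
        | decodeWithDepth-encode φ = refl
decode-encode (at 𝐎 i φ)
  rewrite unpair-pair 1 (pair i (encodeWithDepth φ)) | unpair-pair i (encodeWithDepth φ)
        | decodeWithDepth-encode φ = refl
decode-encode (glob 𝐏 φ) rewrite unpair-pair 2 (encodeWithDepth φ) | decodeWithDepth-encode φ = refl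
decode-encode (glob 𝐎 φ) rewrite unpair-pair 3 (encodeWithDepth φ) | decodeWithDepth-encode φ = refl

encode-injective : ∀ {s t} → encode s ≡ encode t → s ≡ t
encode-injective {s} {t} eq = trans (sym (decode-encode s)) (trans (cong decode eq) (decode-encode t))

_≟_ : DecidableEquality GState
s ≟ t = map′ encode-injective (cong encode) (encode s ℕ.≟ encode t)

sumBy : {A : Set} → (A → ℕ) → List A → ℕ
sumBy f xs = sum (map f xs)

─-↭ : ∀ {A : Set} {P : Pred A 0ℓ} {xs} (p : Any P xs) → xs ↭ Any.lookup p ∷ (xs ─ p)
─-↭ (here _)              = ↭-refl
─-↭ {xs = x ∷ _} (there p) = ↭-trans (↭-prep x (─-↭ p)) (↭-swap x (Any.lookup p) ↭-refl)

module _ {A : Set} {P : Pred A 0ℓ} {D : List A} (p : Any P D) where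

  lookup-∈ : Any.lookup p ∈ D
  lookup-∈ = ∈-lookup (Any.index p)

  ∈-─-split : ∀ {x} → x ∈ D → x ≡ Any.lookup p ⊎ x ∈ (D ─ p)
  ∈-─-split x∈D = Any.toSum (∈-resp-↭ (─-↭ p) x∈D)

  ∈-duplicate : ∀ {x} → x ∈ D → x ∈ (Any.lookup p ∷ Any.lookup p ∷ (D ─ p))
  ∈-duplicate = [ here , there ∘ there ]′ ∘ ∈-─-split

  ∈-─⁻ : ∀ {x} → x ∈ (D ─ p) → x ∈ D
  ∈-─⁻ x∈D─p = ∈-resp-↭ (↭-sym (─-↭ p)) (there x∈D─p)

  duplicate-⊆ : (Any.lookup p ∷ Any.lookup p ∷ (D ─ p)) ⊆ D
  duplicate-⊆ (here refl)         = lookup-∈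
  duplicate-⊆ (there (here refl)) = lookup-∈
  duplicate-⊆ (there (there x∈))  = ∈-─⁻ x∈

  All-─ : ∀ {Q : Pred A 0ℓ} → All Q D → All Q (D ─ p)
  All-─ qs = All.tail (All-resp-↭ (─-↭ p) qs)

  Any-─ : ∀ {Q : Pred A 0ℓ} → Any Q D → ¬ Q (Any.lookup p) → Any Q (D ─ p)
  Any-─ q ¬q with Any-resp-↭ (─-↭ p) q
  ... | here qp  = ⊥-elim (¬q qp)
  ... | there q′ = q′

  sumBy-─ : ∀ f → sumBy f D ≡ f (Any.lookup p) + sumBy f (D ─ p)
  sumBy-─ f = sum-↭ (map⁺ f (─-↭ p))

sumBy-mono-≤ : ∀ {A : Set} {f h : A → ℕ} D → (∀ y → f y ≤ h y) → sumBy f D ≤ sumBy h D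
sumBy-mono-≤ []      f≤h = z≤n
sumBy-mono-≤ (y ∷ D) f≤h = ℕ.+-mono-≤ (f≤h y) (sumBy-mono-≤ D f≤h)

sumBy-mono-< : ∀ {A : Set} {f h : A → ℕ} {D y} → (∀ y → f y ≤ h y) → y ∈ D → f y < h y → sumBy f D < sumBy h D
sumBy-mono-< {D = _ ∷ D} f≤h (here refl) fy<hy = ℕ.+-mono-<-≤ fy<hy (sumBy-mono-≤ D f≤h)
sumBy-mono-< {D = x ∷ _} f≤h (there y∈D) fy<hy = ℕ.+-mono-≤-< (f≤h x) (sumBy-mono-< f≤h y∈D fy<hy)

≤-sumBy : ∀ {A : Set} (f : A → ℕ) {D y} → y ∈ D → f y ≤ sumBy f D
≤-sumBy f (here refl)          = m≤m+n _ _
≤-sumBy f {x ∷ _} (there y∈D) = ≤-trans (≤-sumBy f y∈D) (m≤n+m _ (f x))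

sumBy-replace : ∀ {A : Set} (f : A → ℕ) {P : Pred A 0ℓ} {D} (p : Any P D) {y} →
                f y < f (Any.lookup p) → sumBy f (y ∷ (D ─ p)) < sumBy f D
sumBy-replace f p fy<fp rewrite sumBy-─ p f = ℕ.+-monoˡ-< _ fy<fp

lookup-lose : ∀ {A : Set} {P : Pred A 0ℓ} {x xs} (x∈xs : x ∈ xs) (px : P x) → Any.lookup (lose {P = P} x∈xs px) ≡ x
lookup-lose (here refl) px = refl
lookup-lose (there x∈xs) px = lookup-lose x∈xs px

occurrence : GState → GState → ℕ
occurrence x y with x ≟ y
... | yes _ = 1
... | no _  = 0

mult : GState → DState → ℕ
mult x = sumBy (occurrence x)

occurrence-self : ∀ x → occurrence x x ≡ 1
occurrence-self x with x ≟ x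
... | yes _   = refl
... | no x≢x = ⊥-elim (x≢x refl)

occurrence-≡ : ∀ {x y} → x ≡ y → occurrence x y ≡ 1
occurrence-≡ {x} refl = occurrence-self x

occurrence-≢ : ∀ {x y} → x ≢ y → occurrence x y ≡ 0
occurrence-≢ {x} {y} x≢y with x ≟ y
... | yes x≡y = ⊥-elim (x≢y x≡y)
... | no _    = refl

mult-↭ : ∀ x {D D′} → D ↭ D′ → mult x D ≡ mult x D′
mult-↭ x D↭D′ = sum-↭ (map⁺ (occurrence x) D↭D′)

mult-pos⇒∈ : ∀ {x} D → 0 < mult x D → x ∈ D
mult-pos⇒∈ {x} (y ∷ D) pos with x ≟ y
... | yes x≡y = here x≡y
... | no _    = there (mult-pos⇒∈ D pos)

elementary? : ∀ s → ElemS s ⊎ NonElem s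
elementary? s with isElem s
... | true  = inj₁ refl
... | false = inj₂ refl

nonElem? : ∀ s → Dec (NonElem s)
nonElem? s = isElem s Bool.≟ false

ElemS⇒¬NonElem : ∀ {s} → ElemS s → ¬ NonElem s
ElemS⇒¬NonElem elem nonElem with () ← trans (sym elem) nonElem

-- □ and ◇ weigh more than the guards ¬ R(i,j) ∨ _ and R(i,j) ∧ _ that their children add.
sizeForm : Form → ℕ
sizeForm (φ ∧' ψ)  = suc (sizeForm φ + sizeForm ψ)
sizeForm (φ ∨' ψ)  = suc (sizeForm φ + sizeForm ψ)
sizeForm (φ ⇒' ψ)  = suc (sizeForm φ + sizeForm ψ)
sizeForm (¬' φ)    = suc (sizeForm φ)
sizeForm (at' _ φ) = suc (sizeForm φ)
sizeForm (□' φ)    = 4 + sizeForm φ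
sizeForm (◇' φ)    = 4 + sizeForm φ
sizeForm _         = 1

size : GState → ℕ
size (at _ _ φ) = sizeForm φ
size (glob _ φ) = suc (sizeForm φ)

size-child : ∀ s → .(NonElem s) → ∀ x → size (child s x) < size s
size-child (glob Q φ)          _ x     = ≤-refl
size-child (at Q i (φ ∧' ψ))  _ true  = s≤s (m≤m+n _ _)
size-child (at Q i (φ ∧' ψ))  _ false = s≤s (m≤n+m _ _)
size-child (at Q i (φ ∨' ψ))  _ true  = s≤s (m≤m+n _ _)
size-child (at Q i (φ ∨' ψ))  _ false = s≤s (m≤n+m _ _)
size-child (at Q i (φ ⇒' ψ))  _ true  = s≤s (m≤m+n _ _)
size-child (at Q i (φ ⇒' ψ))  _ false = s≤s (m≤n+m _ _)
size-child (at Q i (¬' φ))    _ x     = ≤-refl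
size-child (at Q i (at' j φ)) _ x     = ≤-refl
size-child (at Q i (□' φ))    _ x     = ℕ.n<1+n _
size-child (at Q i (◇' φ))    _ x     = ℕ.n≤1+n _
size-child (at Q i (var _))   () x
size-child (at Q i (nom _))   () x
size-child (at Q i (rel _ _)) () x

enumIx : ∀ s → .(NonElem s) → ℕ → Ix s
enumIx (glob Q φ)          _ n = n
enumIx (at Q i (φ ∧' ψ))  _ n = n ℕ.≡ᵇ 0
enumIx (at Q i (φ ∨' ψ))  _ n = n ℕ.≡ᵇ 0
enumIx (at Q i (φ ⇒' ψ))  _ n = n ℕ.≡ᵇ 0
enumIx (at Q i (¬' φ))    _ n = tt
enumIx (at Q i (at' j φ)) _ n = tt
enumIx (at Q i (□' φ))    _ n = n
enumIx (at Q i (◇' φ))    _ n = n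
enumIx (at Q i (var _))   () n
enumIx (at Q i (nom _))   () n
enumIx (at Q i (rel _ _)) () n

enumIx-surjective : ∀ s .(ne : NonElem s) x → ∃ λ n → enumIx s ne n ≡ x
enumIx-surjective (glob Q φ)          _ x     = x , refl
enumIx-surjective (at Q i (φ ∧' ψ))  _ true  = 0 , refl
enumIx-surjective (at Q i (φ ∧' ψ))  _ false = 1 , refl
enumIx-surjective (at Q i (φ ∨' ψ))  _ true  = 0 , refl
enumIx-surjective (at Q i (φ ∨' ψ))  _ false = 1 , refl
enumIx-surjective (at Q i (φ ⇒' ψ))  _ true  = 0 , refl
enumIx-surjective (at Q i (φ ⇒' ψ))  _ false = 1 , refl
enumIx-surjective (at Q i (¬' φ))    _ tt    = 0 , refl
enumIx-surjective (at Q i (at' j φ)) _ tt    = 0 , refl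
enumIx-surjective (at Q i (□' φ))    _ x     = x , refl
enumIx-surjective (at Q i (◇' φ))    _ x     = x , refl
enumIx-surjective (at Q i (var _))   () x
enumIx-surjective (at Q i (nom _))   () x
enumIx-surjective (at Q i (rel _ _)) () x

infix 4 _⊭_

_⊭_ : Model → GState → Set
M ⊭ at 𝐏 i φ  = ¬ (M , g M i ⊨ φ)
M ⊭ at 𝐎 i φ  = M , g M i ⊨ φ
M ⊭ glob 𝐏 φ = ∃ λ w → ¬ (M , w ⊨ φ)
M ⊭ glob 𝐎 φ = ∀ w → M , w ⊨ φ

WinG-elementary⇒¬⊭ : ∀ {M s} → ElemS s → WinG M s → ¬ M ⊭ s
WinG-elementary⇒¬⊭ {s = at 𝐏 i φ} _ (leafW _ holds) refuted = refuted holds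
WinG-elementary⇒¬⊭ {s = at 𝐎 i φ} _ (leafW _ fails) refuted = fails refuted
WinG-elementary⇒¬⊭ {s = s} elem (pickI nonElem _ _ _) = ⊥-elim (ElemS⇒¬NonElem {s} elem nonElem)
WinG-elementary⇒¬⊭ {s = s} elem (allY nonElem _ _)   = ⊥-elim (ElemS⇒¬NonElem {s} elem nonElem)

nomBound : Form → ℕ
nomBound (var p)   = 0
nomBound (nom i)   = suc i
nomBound (rel i j) = suc i ⊔ suc j
nomBound (φ ∧' ψ)  = nomBound φ ⊔ nomBound ψ
nomBound (φ ∨' ψ)  = nomBound φ ⊔ nomBound ψ
nomBound (φ ⇒' ψ)  = nomBound φ ⊔ nomBound ψ
nomBound (¬' φ)    = nomBound φ
nomBound (at' i φ) = suc i ⊔ nomBound φ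
nomBound (□' φ)    = nomBound φ
nomBound (◇' φ)    = nomBound φ

stateBound : GState → ℕ
stateBound (at _ i φ) = suc i ⊔ nomBound φ
stateBound (glob _ φ) = nomBound φ

AgreeBelow : {A : Set} → ℕ → (Nom → A) → (Nom → A) → Set
AgreeBelow b h h′ = ∀ k → k < b → h k ≡ h′ k

AgreeBelow-≤ : ∀ {A : Set} {a b} {h h′ : Nom → A} → a ≤ b → AgreeBelow b h h′ → AgreeBelow a h h′
AgreeBelow-≤ a≤b agree k k<a = agree k (<-≤-trans k<a a≤b)

reassign : (M : Model) → (Nom → W M) → Model
reassign M h = record M { g = h }

⊨-reassign : ∀ M {h} φ {w} → AgreeBelow (nomBound φ) h (g M) →
             (reassign M h , w ⊨ φ) ⇔ (M , w ⊨ φ)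
⊨-reassign M (var p)   agree = mk⇔ id id
⊨-reassign M (nom i)   agree rewrite agree i ≤-refl = mk⇔ id id
⊨-reassign M (rel i j) agree
  rewrite agree i (s≤s (m≤m⊔n i j)) | agree j (s≤s (m≤n⊔m i j)) = mk⇔ id id
⊨-reassign M (φ ∧' ψ)  agree =
  ⊨-reassign M φ (AgreeBelow-≤ (m≤m⊔n _ _) agree) ×-⇔ ⊨-reassign M ψ (AgreeBelow-≤ (m≤n⊔m _ _) agree)
⊨-reassign M (φ ∨' ψ)  agree =
  ⊨-reassign M φ (AgreeBelow-≤ (m≤m⊔n _ _) agree) ⊎-⇔ ⊨-reassign M ψ (AgreeBelow-≤ (m≤n⊔m _ _) agree)
⊨-reassign M (φ ⇒' ψ)  agree =
  →-cong-⇔ (⊨-reassign M φ (AgreeBelow-≤ (m≤m⊔n _ _) agree)) (⊨-reassign M ψ (AgreeBelow-≤ (m≤n⊔m _ _) agree))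
⊨-reassign M (¬' φ)    agree = ¬-cong-⇔ (⊨-reassign M φ agree)
⊨-reassign M (at' i φ) agree
  rewrite agree i (m≤m⊔n (suc i) (nomBound φ)) = ⊨-reassign M φ (AgreeBelow-≤ (m≤n⊔m _ _) agree)
⊨-reassign M (□' φ)    agree =
  mk⇔ (λ f v r → Equivalence.to (⊨-reassign M φ agree) (f v r))
      (λ f v r → Equivalence.from (⊨-reassign M φ agree) (f v r))
⊨-reassign M (◇' φ)    agree =
  mk⇔ (λ (v , r , holds) → v , r , Equivalence.to (⊨-reassign M φ agree) holds)
      (λ (v , r , holds) → v , r , Equivalence.from (⊨-reassign M φ agree) holds)

⊭-reassign : ∀ M {h} s → AgreeBelow (stateBound s) h (g M) → M ⊭ s → reassign M h ⊭ s
⊭-reassign M (at 𝐏 i φ) agree refuted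
  rewrite agree i (m≤m⊔n (suc i) (nomBound φ)) =
  refuted ∘ Equivalence.to (⊨-reassign M φ (AgreeBelow-≤ (m≤n⊔m _ _) agree))
⊭-reassign M (at 𝐎 i φ) agree refuted
  rewrite agree i (m≤m⊔n (suc i) (nomBound φ)) =
  Equivalence.from (⊨-reassign M φ (AgreeBelow-≤ (m≤n⊔m _ _) agree)) refuted
⊭-reassign M (glob 𝐏 φ) agree (w , fails) = w , fails ∘ Equivalence.to (⊨-reassign M φ agree)
⊭-reassign M (glob 𝐎 φ) agree holds w = Equivalence.from (⊨-reassign M φ agree) (holds w)

update : {A : Set} → (Nom → A) → Nom → A → Nom → A
update h j v k with k ℕ.≟ j
... | yes _ = v
... | no _  = h k

update-hit : ∀ {A : Set} (h : Nom → A) j v → update h j v j ≡ v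
update-hit h j v with j ℕ.≟ j
... | yes _   = refl
... | no j≢j = ⊥-elim (j≢j refl)

update-fresh : ∀ {A : Set} (h : Nom → A) {j b} v → b ≤ j → AgreeBelow b (update h j v) h
update-fresh h {j} v b≤j k k<b with k ℕ.≟ j
... | yes refl = ⊥-elim (ℕ.<⇒≱ k<b b≤j)
... | no _     = refl

update-idle : ∀ {A : Set} (h : Nom → A) j {b} → AgreeBelow b (update h j (h j)) h
update-idle h j k _ with k ℕ.≟ j
... | yes refl = refl
... | no _     = refl

infixl 30 _[_≔_]

_[_≔_] : (M : Model) → Nom → W M → Model
M [ j ≔ v ] = reassign M (update (g M) j v)

⊨-fresh : ∀ M φ {j} v {w} → nomBound φ ≤ j → (M [ j ≔ v ] , w ⊨ φ) ⇔ (M , w ⊨ φ)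
⊨-fresh M φ v fresh = ⊨-reassign M φ (update-fresh (g M) v fresh)

module Fresh (M : Model) {i j : Nom} (φ : Form) (v : W M) (fresh : suc i ⊔ nomBound φ ≤ j) where

  keeps-i : g (M [ j ≔ v ]) i ≡ g M i
  keeps-i = update-fresh (g M) v fresh i (m≤m⊔n (suc i) (nomBound φ))

  names-v : g (M [ j ≔ v ]) j ≡ v
  names-v = update-hit (g M) j v

  keeps-φ : ∀ {w} → (M [ j ≔ v ] , w ⊨ φ) ⇔ (M , w ⊨ φ)
  keeps-φ = ⊨-fresh M φ v (≤-trans (m≤n⊔m (suc i) (nomBound φ)) fresh)

⊭-fresh : ∀ M s {j} v → stateBound s ≤ j → M ⊭ s → M [ j ≔ v ] ⊭ s
⊭-fresh M s v fresh = ⊭-reassign M s (update-fresh (g M) v fresh)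

⊭-idle : ∀ M s j → M ⊭ s → M [ j ≔ g M j ] ⊭ s
⊭-idle M s j = ⊭-reassign M s (update-idle (g M) j)

module Classical (em : ExcludedMiddle 0ℓ) where

  dne : ∀ {A : Set} → ¬ ¬ A → A
  dne = em⇒dne em

  Descend : Player → Model → GState → Set
  Descend Me  M s = ∀ x → M ⊭ child s x
  Descend You M s = ∀ j → stateBound s ≤ j → ∃₂ λ v x → M [ j ≔ v ] ⊭ child s x

  -- A witness world chosen by You need not have a name: a fresh nominal j is reassigned to it.
  ⊭-descend : ∀ M s → .(NonElem s) → M ⊭ s → Descend (owner s) M s
  ⊭-descend M (at 𝐏 i (φ ∧' ψ)) _ refuted j _ with em {M , g M i ⊨ φ}
  ... | yes holds = g M j , false , ⊭-idle M (at 𝐏 i ψ) j (λ holds′ → refuted (holds , holds′))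
  ... | no fails  = g M j , true , ⊭-idle M (at 𝐏 i φ) j fails
  ⊭-descend M (at 𝐏 i (φ ∨' ψ)) _ refuted true  = refuted ∘ inj₁
  ⊭-descend M (at 𝐏 i (φ ∨' ψ)) _ refuted false = refuted ∘ inj₂
  ⊭-descend M (at 𝐏 i (φ ⇒' ψ)) _ refuted true  = dne (λ fails → refuted (⊥-elim ∘ fails))
  ⊭-descend M (at 𝐏 i (φ ⇒' ψ)) _ refuted false = refuted ∘ const
  ⊭-descend M (at 𝐏 i (¬' φ))    _ refuted tt    = dne refuted
  ⊭-descend M (at 𝐏 i (at' k φ)) _ refuted tt    = refuted
  ⊭-descend M (at 𝐏 i (□' φ))    _ refuted j fresh
    with em {∃ λ v → R M (g M i) v × ¬ (M , v ⊨ φ)}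
  ... | no noCounterexample = ⊥-elim (refuted λ v r → dne λ fails → noCounterexample (v , r , fails))
  ... | yes (v , r , fails) =
    v , j , [ (λ ¬r → ¬r (subst₂ (R M) (sym keeps-i) (sym names-v) r))
            , fails ∘ subst (λ w → M , w ⊨ φ) names-v ∘ Equivalence.to keeps-φ ]′
    where open Fresh M φ v fresh
  ⊭-descend M (at 𝐏 i (◇' φ))    _ refuted j (r , holds) = refuted (g M j , r , holds)
  ⊭-descend M (glob 𝐏 φ)         _ (w , fails) j fresh =
    w , j , fails ∘ subst (λ w → M , w ⊨ φ) (update-hit (g M) j w) ∘ Equivalence.to (⊨-fresh M φ w fresh)
  ⊭-descend M (at 𝐎 i (φ ∧' ψ)) _ holds true  = proj₁ holds
  ⊭-descend M (at 𝐎 i (φ ∧' ψ)) _ holds false = proj₂ holds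
  ⊭-descend M (at 𝐎 i (φ ∨' ψ)) _ (inj₁ holds) j _ = g M j , true , ⊭-idle M (at 𝐎 i φ) j holds
  ⊭-descend M (at 𝐎 i (φ ∨' ψ)) _ (inj₂ holds) j _ = g M j , false , ⊭-idle M (at 𝐎 i ψ) j holds
  ⊭-descend M (at 𝐎 i (φ ⇒' ψ)) _ holds j _ with em {M , g M i ⊨ φ}
  ... | yes holds′ = g M j , false , ⊭-idle M (at 𝐎 i ψ) j (holds holds′)
  ... | no fails   = g M j , true , ⊭-idle M (at 𝐏 i φ) j fails
  ⊭-descend M (at 𝐎 i (¬' φ))    _ holds j _ = g M j , tt , ⊭-idle M (at 𝐏 i φ) j holds
  ⊭-descend M (at 𝐎 i (at' k φ)) _ holds j _ = g M j , tt , ⊭-idle M (at 𝐎 k φ) j holds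
  ⊭-descend M (at 𝐎 i (□' φ))    _ holds j with em {R M (g M i) (g M j)}
  ... | yes r = inj₂ (holds (g M j) r)
  ... | no ¬r = inj₁ ¬r
  ⊭-descend M (at 𝐎 i (◇' φ))    _ (v , r , holds) j fresh =
    v , j , subst₂ (R M) (sym keeps-i) (sym names-v) r
          , Equivalence.from keeps-φ (subst (λ w → M , w ⊨ φ) (sym names-v) holds)
    where open Fresh M φ v fresh
  ⊭-descend M (glob 𝐎 φ)         _ holds i = holds (g M i)
  ⊭-descend M (at Q i (var _))   () refuted
  ⊭-descend M (at Q i (nom _))   () refuted
  ⊭-descend M (at Q i (rel _ _)) () refuted

  Ascend : Player → Model → GState → Set
  Ascend Me  M s = (∀ x → M ⊭ child s x) → M ⊭ s
  Ascend You M s = ∀ x → M ⊭ child s x → M ⊭ s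

  ⊭-ascend : ∀ M → Named M → ∀ s → .(NonElem s) → Ascend (owner s) M s
  ⊭-ascend M named (at 𝐏 i (φ ∧' ψ)) _ true  refuted = refuted ∘ proj₁
  ⊭-ascend M named (at 𝐏 i (φ ∧' ψ)) _ false refuted = refuted ∘ proj₂
  ⊭-ascend M named (at 𝐏 i (φ ∨' ψ)) _ refuted = [ refuted true , refuted false ]′
  ⊭-ascend M named (at 𝐏 i (φ ⇒' ψ)) _ refuted = λ f → refuted false (f (refuted true))
  ⊭-ascend M named (at 𝐏 i (¬' φ))    _ refuted = λ f → f (refuted tt)
  ⊭-ascend M named (at 𝐏 i (at' k φ)) _ refuted = refuted tt
  ⊭-ascend M named (at 𝐏 i (□' φ))    _ j refuted =
    λ f → refuted (inj₂ (f (g M j) (dne (refuted ∘ inj₁))))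
  ⊭-ascend M named (at 𝐏 i (◇' φ))    _ refuted (v , r , holds) with named v
  ... | j , refl = refuted j (r , holds)
  ⊭-ascend M named (glob 𝐏 φ)         _ j fails = g M j , fails
  ⊭-ascend M named (at 𝐎 i (φ ∧' ψ)) _ holds = holds true , holds false
  ⊭-ascend M named (at 𝐎 i (φ ∨' ψ)) _ true  = inj₁
  ⊭-ascend M named (at 𝐎 i (φ ∨' ψ)) _ false = inj₂
  ⊭-ascend M named (at 𝐎 i (φ ⇒' ψ)) _ true  fails = ⊥-elim ∘ fails
  ⊭-ascend M named (at 𝐎 i (φ ⇒' ψ)) _ false holds = const holds
  ⊭-ascend M named (at 𝐎 i (¬' φ))    _ tt fails = fails
  ⊭-ascend M named (at 𝐎 i (at' k φ)) _ tt holds = holds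
  ⊭-ascend M named (at 𝐎 i (□' φ))    _ holds v r with named v
  ... | j , refl = [ (λ ¬r → ⊥-elim (¬r r)) , id ]′ (holds j)
  ⊭-ascend M named (at 𝐎 i (◇' φ))    _ j (r , holds) = g M j , r , holds
  ⊭-ascend M named (glob 𝐎 φ)         _ holds w with named w
  ... | j , refl = holds j
  ⊭-ascend M named (at Q i (var _))   ()
  ⊭-ascend M named (at Q i (nom _))   ()
  ⊭-ascend M named (at Q i (rel _ _)) ()

  least : (P : ℕ → Set) → ∃ P → ∃ λ m → P m × (∀ {n} → n < m → ¬ P n)
  least P (m , pm) = below m (m , ≤-refl , pm)
    where
    below : ∀ b → ∃ (λ m → m ≤ b × P m) → ∃ λ m → P m × (∀ {n} → n < m → ¬ P n)
    below zero (.0 , z≤n , p0) = 0 , p0 , λ ()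
    below (suc b) (m , m≤1+b , pm) with em {∃ λ n → n ≤ b × P n}
    ... | yes smaller = below b smaller
    ... | no none     = m , pm , λ n<m pn → none (_ , ℕ.≤-pred (≤-trans n<m m≤1+b) , pn)

  -- Classes are represented by their least elements.
  module Quotient (_≈_ : Rel ℕ 0ℓ) (isEquivalence : IsEquivalence _≈_) where
    open IsEquivalence isEquivalence renaming (refl to ≈-refl; sym to ≈-sym; trans to ≈-trans)

    opaque
      leastRep : ∀ n → ∃ λ m → m ≈ n × (∀ {k} → k < m → ¬ k ≈ n)
      leastRep n = least (_≈ n) (n , ≈-refl)

      canonical : ℕ → ℕ
      canonical n = proj₁ (leastRep n)

      canonical-≈ : ∀ n → canonical n ≈ n
      canonical-≈ n = proj₁ (proj₂ (leastRep n))

      canonical-resp : ∀ {a b} → a ≈ b → canonical a ≡ canonical b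
      canonical-resp {a} {b} a≈b = ℕ.≤-antisym
        (ℕ.≮⇒≥ λ b<a → proj₂ (proj₂ (leastRep a)) b<a (≈-trans (canonical-≈ b) (≈-sym a≈b)))
        (ℕ.≮⇒≥ λ a<b → proj₂ (proj₂ (leastRep b)) a<b (≈-trans (canonical-≈ a) a≈b))

    Carrier : Set
    Carrier = Σ ℕ λ n → canonical n ≡ n

    [_] : ℕ → Carrier
    [ n ] = canonical n , canonical-resp (canonical-≈ n)

    carrier-≡ : ∀ {a b} {p : canonical a ≡ a} {q : canonical b ≡ b} → a ≡ b → (a , p) ≡ (b , q)
    carrier-≡ refl = cong (_ ,_) (ℕ.≡-irrelevant _ _)

    [_]-surjective : ∀ w → ∃ λ n → [ n ] ≡ w
    [ n , canonical≡n ]-surjective = n , carrier-≡ canonical≡n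

    ≈⇒[≡] : ∀ {a b} → a ≈ b → [ a ] ≡ [ b ]
    ≈⇒[≡] a≈b = carrier-≡ (canonical-resp a≈b)

    [≡]⇒≈ : ∀ {a b} → [ a ] ≡ [ b ] → a ≈ b
    [≡]⇒≈ {a} {b} eq =
      ≈-trans (≈-sym (canonical-≈ a)) (subst (_≈ b) (sym (cong proj₁ eq)) (canonical-≈ b))

  module TermModel (_≈_ : Rel ℕ 0ℓ) (isEquivalence : IsEquivalence _≈_)
                   (Rₙ : Nom → Nom → Set) (Vₙ : PVar → Nom → Set) where
    open Quotient _≈_ isEquivalence public

    model : Model
    model = record
      { W = Carrier
      ; R = λ a b → ∃₂ λ k l → [ k ] ≡ a × [ l ] ≡ b × Rₙ k l
      ; V = λ p a → ∃ λ k → [ k ] ≡ a × Vₙ p k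
      ; g = [_]
      }

    named : Named model
    named = [_]-surjective

    ⊨var⁻ : ∀ {p i} → model , [ i ] ⊨ var p → ∃ λ k → k ≈ i × Vₙ p k
    ⊨var⁻ (k , eq , v) = k , [≡]⇒≈ eq , v

    ⊨rel⁻ : ∀ {k l} → R model [ k ] [ l ] → ∃₂ λ k′ l′ → k′ ≈ k × l′ ≈ l × Rₙ k′ l′
    ⊨rel⁻ (k′ , l′ , eqk , eql , r) = k′ , l′ , [≡]⇒≈ eqk , [≡]⇒≈ eql , r

-- Soundness

module Soundness (em : ExcludedMiddle 0ℓ) where
  open Classical em

  module Image (M : Model) =
    TermModel (λ a b → g M a ≡ g M b) (On.isEquivalence (g M) isEquivalence)
              (λ k l → R M (g M k) (g M l)) (λ p k → V M p (g M k))

  ⊭-image : ∀ M s → ElemS s → M ⊭ s → Image.model M ⊭ s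
  ⊭-image M (at 𝐏 i (var p))   _ fails holds with Image.⊨var⁻ M holds
  ... | k , gk≡gi , v = fails (subst (V M p) gk≡gi v)
  ⊭-image M (at 𝐎 i (var p))   _ holds = i , refl , holds
  ⊭-image M (at 𝐏 i (nom k))   _ fails = fails ∘ Image.[≡]⇒≈ M
  ⊭-image M (at 𝐎 i (nom k))   _ holds = Image.≈⇒[≡] M holds
  ⊭-image M (at 𝐏 i (rel k l)) _ fails holds with Image.⊨rel⁻ M holds
  ... | k′ , l′ , gk′≡gk , gl′≡gl , r = fails (subst₂ (R M) gk′≡gk gl′≡gl r)
  ⊭-image M (at 𝐎 i (rel k l)) _ holds = k , l , refl , refl , holds

  ⊭-descend-at : ∀ M {D} (p : Any NonElem D) → All (M ⊭_) D →
                 Descend (owner (Any.lookup p)) M (Any.lookup p)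
  ⊭-descend-at M p refuted = ⊭-descend M _ (lookup-result p) (All.lookup refuted (lookup-∈ p))

  DWin⇒¬All⊭ : ∀ {ρ D} → DWin ρ D → ∀ M → ¬ All (M ⊭_) D
  DWin⇒¬All⊭ (leafD elementary gameValid) M refuted
    with s , s∈D , won ← find (gameValid (Image.model M) (Image.named M)) =
    WinG-elementary⇒¬⊭ elem won (⊭-image M s elem (All.lookup refuted s∈D))
    where
    elem : ElemS s
    elem = All.lookup elementary s∈D
  -- A nominal beyond all those occurring in D can name You's witness without disturbing D.
  DWin⇒¬All⊭ {ρ} {D} (stepY n isYou next) M refuted =
    youMoves (subst (λ o → Descend o M (Any.lookup p)) isYou (⊭-descend-at M p refuted)
               fresh (≤-sumBy stateBound (lookup-∈ p)))
    where
    p : Any NonElem D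
    p = pick ρ D n
    fresh : Nom
    fresh = sumBy stateBound D
    youMoves : ¬ ∃₂ λ v x → M [ fresh ≔ v ] ⊭ child (Any.lookup p) x
    youMoves (v , x , refutedChild) =
      DWin⇒¬All⊭ (next x) (M [ fresh ≔ v ]) (refutedChild ∷ All.tabulate λ {y} y∈ →
        ⊭-fresh M y v (≤-sumBy stateBound (∈-─⁻ p y∈)) (All.lookup (All-─ p refuted) y∈))
  DWin⇒¬All⊭ {ρ} {D} (stepI n isMe x next) M refuted =
    DWin⇒¬All⊭ next M (refutedChild ∷ All-─ (pick ρ D n) refuted)
    where
    refutedChild : M ⊭ child (Any.lookup (pick ρ D n)) x
    refutedChild = subst (λ o → Descend o M (Any.lookup (pick ρ D n))) isMe
                     (⊭-descend-at M (pick ρ D n) refuted) x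
  DWin⇒¬All⊭ {ρ} {D} (dupI n isMe next) M refuted =
    DWin⇒¬All⊭ next M (refutedPick ∷ refutedPick ∷ All-─ (pick ρ D n) refuted)
    where
    refutedPick : M ⊭ Any.lookup (pick ρ D n)
    refutedPick = All.lookup refuted (lookup-∈ (pick ρ D n))

  Winning⇒Valid : ∀ φ → Winning (glob 𝐏 φ ∷ []) → Valid φ
  Winning⇒Valid φ (ρ , win) M w = dne λ fails → DWin⇒¬All⊭ win M ((w , fails) ∷ [])

-- A fair regulation

YouState MeState : GState → Set
YouState s = NonElem s × owner s ≡ You
MeState  s = NonElem s × owner s ≡ Me

_≟ₚ_ : DecidableEquality Player
Me  ≟ₚ Me  = yes refl
You ≟ₚ You = yes refl
Me  ≟ₚ You = no λ ()
You ≟ₚ Me  = no λ ()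

youState? : U.Decidable YouState
youState? s = nonElem? s ×-dec (owner s ≟ₚ You)

meState? : U.Decidable MeState
meState? s = nonElem? s ×-dec (owner s ≟ₚ Me)

-- You's states are regulated first, and among the candidates the least key is chosen:
-- duplicating a state raises its key, so I can steer the regulation to any of my states.
Candidate : DState → GState → Set
Candidate D y = NonElem y × (Any YouState D → owner y ≡ You)

candidate? : ∀ D → U.Decidable (Candidate D)
candidate? D y = nonElem? y ×-dec (Any.any? youState? D →-dec (owner y ≟ₚ You))

Candidate-↭ : ∀ {D D′ y} → D ↭ D′ → Candidate D y → Candidate D′ y
Candidate-↭ D↭D′ (nonElem , prefersYou) = nonElem , prefersYou ∘ Any-resp-↭ (↭-sym D↭D′)

key : DState → GState → ℕ
key D y = pair (mult y D) (encode y)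

key-injective : ∀ {D D′ x y} → key D x ≡ key D′ y → x ≡ y
key-injective {D} {D′} {x} {y} eq =
  encode-injective (proj₂ (pair-injective {mult x D} {_} {mult y D′} eq))

key-↭ : ∀ {D D′} y → D ↭ D′ → key D y ≡ key D′ y
key-↭ y D↭D′ = cong (λ m → pair m (encode y)) (mult-↭ y D↭D′)

someCandidate : ∀ D → Any NonElem D → ∃ λ y → y ∈ D × Candidate D y
someCandidate D nonElem with Any.any? youState? D
... | yes you  = Any.lookup you , lookup-∈ you , proj₁ (lookup-result you) , const (proj₂ (lookup-result you))
... | no noYou = Any.lookup nonElem , lookup-∈ nonElem , lookup-result nonElem , ⊥-elim ∘ noYou

module _ (D : DState) (nonElem : Any NonElem D) where

  best : GState
  best = argmin (key D) (proj₁ (someCandidate D nonElem)) (filter (candidate? D) D)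

  best-candidate : best ∈ D × Candidate D best
  best-candidate = argmin-all (key D) {P = λ y → y ∈ D × Candidate D y}
    (proj₂ (someCandidate D nonElem)) (All.tabulate (∈-filter⁻ (candidate? D)))

  best-least : ∀ {y} → y ∈ D → Candidate D y → key D best ≤ key D y
  best-least y∈D candidate =
    All.lookup (f[argmin]≤f[xs] _ (filter (candidate? D) D)) (∈-filter⁺ (candidate? D) y∈D candidate)

best-↭ : ∀ {D D′} n n′ → D ↭ D′ → best D n ≡ best D′ n′
best-↭ {D} {D′} n n′ D↭D′ = key-injective {D} {D} (ℕ.≤-antisym
  (best-least D n (∈-resp-↭ (↭-sym D↭D′) b′∈D′) (Candidate-↭ {y = best D′ n′} (↭-sym D↭D′) b′-candidate))
  (begin
    key D (best D′ n′)  ≡⟨ key-↭ _ D↭D′ ⟩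
    key D′ (best D′ n′) ≤⟨ best-least D′ n′ (∈-resp-↭ D↭D′ b∈D) (Candidate-↭ {y = best D n} D↭D′ b-candidate) ⟩
    key D′ (best D n)   ≡⟨ key-↭ _ D↭D′ ⟨
    key D (best D n)    ∎))
  where
  open ℕ.≤-Reasoning
  b∈D : best D n ∈ D
  b∈D = proj₁ (best-candidate D n)
  b-candidate : Candidate D (best D n)
  b-candidate = proj₂ (best-candidate D n)
  b′∈D′ : best D′ n′ ∈ D′
  b′∈D′ = proj₁ (best-candidate D′ n′)
  b′-candidate : Candidate D′ (best D′ n′)
  b′-candidate = proj₂ (best-candidate D′ n′)

-- Opaque: unfolding the argmin in later goals makes type checking prohibitively slow.
opaque
  fairPick : (D : DState) → Any NonElem D → Any NonElem D
  fairPick D n = lose {P = NonElem} (proj₁ (best-candidate D n)) (proj₁ (proj₂ (best-candidate D n)))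

  fairPick-best : ∀ D n → Any.lookup (fairPick D n) ≡ best D n
  fairPick-best D n =
    lookup-lose {P = NonElem} (proj₁ (best-candidate D n)) (proj₁ (proj₂ (best-candidate D n)))

fair : Regulation
fair = record
  { pick      = fairPick
  ; invariant = λ n n′ D↭D′ →
      trans (fairPick-best _ n) (trans (best-↭ n n′ D↭D′) (sym (fairPick-best _ n′)))
  }

ElemWin : Model → DState → Set
ElemWin M = Any (λ s → ElemS s × WinG M s)

ElemGameValid : DState → Set₁
ElemGameValid D = ∀ M → Named M → ElemWin M D

¬Any-NonElem⇒All-ElemS : ∀ {D} → ¬ Any NonElem D → All ElemS D
¬Any-NonElem⇒All-ElemS {[]}    _        = []
¬Any-NonElem⇒All-ElemS {s ∷ D} noneNon with elementary? s
... | inj₁ elem    = elem ∷ ¬Any-NonElem⇒All-ElemS (noneNon ∘ there)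
... | inj₂ nonElem = ⊥-elim (noneNon (here nonElem))

-- Whatever is played, a winning elementary state stays in the disjunction.
ElemGameValid⇒DWin : ∀ ρ D → ElemGameValid D → DWin ρ D
ElemGameValid⇒DWin ρ D = go D (<-wellFounded (sumBy size D))
  where
  go : ∀ D → Acc _<_ (sumBy size D) → ElemGameValid D → DWin ρ D
  go D (acc smaller) valid with Any.any? nonElem? D
  ... | no noneNon = leafD (¬Any-NonElem⇒All-ElemS noneNon) λ M named → Any.map proj₂ (valid M named)
  ... | yes n = byOwner (owner s) refl
    where
    p : Any NonElem D
    p = pick ρ D n
    s : GState
    s = Any.lookup p
    advance : ∀ x → DWin ρ (child s x ∷ (D ─ p))
    advance x = go _ (smaller (sumBy-replace size p {child s x} (size-child s (lookup-result p) x)))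
      λ M named → there (Any-─ p (valid M named) λ (elem , _) → ElemS⇒¬NonElem {s} elem (lookup-result p))
    byOwner : ∀ o → owner s ≡ o → DWin ρ D
    byOwner You isYou = stepY n isYou advance
    byOwner Me  isMe  = stepI n isMe _ (advance (enumIx s (lookup-result p) 0))

module _ {D : DState} (n : Any NonElem D) where

  picked : GState
  picked = Any.lookup (pick fair D n)

  rest : DState
  rest = D ─ pick fair D n

  picked-nonElem : NonElem picked
  picked-nonElem = lookup-result (pick fair D n)

  picked-∈ : picked ∈ D
  picked-∈ = lookup-∈ (pick fair D n)

  fair-You : Any YouState D → owner picked ≡ You
  fair-You you = subst (λ s → owner s ≡ You) (sym (fairPick-best D n))
                   (proj₂ (proj₂ (best-candidate D n)) you)

  fair-least : ¬ Any YouState D → ∀ {y} → y ∈ D → NonElem y → key D picked ≤ key D y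
  fair-least noYou y∈D nonElem = subst (λ s → key D s ≤ key D _) (sym (fairPick-best D n))
                                   (best-least D n y∈D (nonElem , ⊥-elim ∘ noYou))

-- The k-th round aims at the (targetIx k)-th choice of the state target k; every pair
-- of a state and a choice is aimed at in infinitely many rounds.
target : ℕ → GState
target k = decode (proj₁ (unpair k))

targetIx : ℕ → ℕ
targetIx k = proj₁ (unpair (proj₂ (unpair k)))

round : GState → ℕ → ℕ → ℕ
round s i r = pair (encode s) (pair i r)

target-round : ∀ s i r → target (round s i r) ≡ s
target-round s i r rewrite unpair-pair (encode s) (pair i r) = decode-encode s

targetIx-round : ∀ s i r → targetIx (round s i r) ≡ i
targetIx-round s i r rewrite unpair-pair (encode s) (pair i r) | unpair-pair i r = refl

≤-round : ∀ s i r → r ≤ round s i r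
≤-round s i r = ≤-trans (n≤pair i r) (n≤pair (encode s) (pair i r))

-- I play the target only when it has a spare copy.
data Step : DState → ℕ → DState → ℕ → Set where
  youMove : ∀ {D k} (n : Any NonElem D) → owner (picked n) ≡ You → (x : Ix (picked n)) →
            Step D k (child (picked n) x ∷ rest n) k
  play    : ∀ {D k} (n : Any NonElem D) → owner (picked n) ≡ Me →
            picked n ≡ target k → 2 ≤ mult (target k) D →
            Step D k (child (picked n) (enumIx (picked n) (picked-nonElem n) (targetIx k)) ∷ rest n) (suc k)
  steer   : ∀ {D k} (n : Any NonElem D) → owner (picked n) ≡ Me →
            target k ∈ D → MeState (target k) → ¬ (picked n ≡ target k × 2 ≤ mult (target k) D) →
            Step D k (picked n ∷ picked n ∷ rest n) k
  skip    : ∀ {D k} → ¬ Any YouState D → ¬ (target k ∈ D × MeState (target k)) → Step D k D (suc k)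

Step-counter : ∀ {D k D′ k′} → Step D k D′ k′ → k′ ≤ suc k
Step-counter (youMove _ _ _)   = ℕ.n≤1+n _
Step-counter (play _ _ _ _)    = ≤-refl
Step-counter (steer _ _ _ _ _) = ℕ.n≤1+n _
Step-counter (skip _ _)        = ≤-refl

Persistent : GState → Set
Persistent s = ElemS s ⊎ MeState s

YouState⇒¬Persistent : ∀ {s} → YouState s → ¬ Persistent s
YouState⇒¬Persistent {s} (nonElem , _) (inj₁ elem)      = ElemS⇒¬NonElem {s} elem nonElem
YouState⇒¬Persistent     (_ , isYou)   (inj₂ (_ , isMe)) with () ← trans (sym isYou) isMe

mult-rest : ∀ {D} (n : Any NonElem D) y → mult y D ≡ occurrence y (picked n) + mult y (rest n)
mult-rest n y = sumBy-─ (pick fair _ n) (occurrence y)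

spare-copy : ∀ {D} (n : Any NonElem D) {s} → picked n ≡ s → 2 ≤ mult s D → s ∈ rest n
spare-copy {D} n {s} p≡s two = mult-pos⇒∈ (rest n) (ℕ.+-cancelˡ-< 1 _ _ (begin-strict
  1                                         <⟨ two ⟩
  mult s D                                  ≡⟨ mult-rest n s ⟩
  occurrence s (picked n) + mult s (rest n) ≡⟨ cong (_+ mult s (rest n)) (occurrence-≡ (sym p≡s)) ⟩
  1 + mult s (rest n)                       ∎))
  where open ℕ.≤-Reasoning

Step-persists : ∀ {D k D′ k′ s} → Step D k D′ k′ → s ∈ D → Persistent s → s ∈ D′
Step-persists (youMove n isYou x) s∈D persistent with ∈-─-split (pick fair _ n) s∈D
... | inj₁ refl  = ⊥-elim (YouState⇒¬Persistent {picked n} (picked-nonElem n , isYou) persistent)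
... | inj₂ s∈rest = there s∈rest
Step-persists (play n _ p≡t two) s∈D _ with ∈-─-split (pick fair _ n) s∈D
... | inj₁ refl  = there (subst (_∈ rest n) (sym p≡t) (spare-copy n p≡t two))
... | inj₂ s∈rest = there s∈rest
Step-persists (steer n _ _ _ _) s∈D _ = ∈-duplicate (pick fair _ n) s∈D
Step-persists (skip _ _)        s∈D _ = s∈D

youSize : GState → ℕ
youSize s with youState? s
... | yes _ = size s
... | no _  = 0

youSize≤size : ∀ s → youSize s ≤ size s
youSize≤size s with youState? s
... | yes _ = ≤-refl
... | no _  = z≤n

youSize-YouState : ∀ {s} → YouState s → youSize s ≡ size s
youSize-YouState {s} you with youState? s
... | yes _    = refl
... | no ¬you = ⊥-elim (¬you you)

youTotal : DState → ℕ
youTotal = sumBy youSize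

youMove-youTotal : ∀ {D} (n : Any NonElem D) → owner (picked n) ≡ You → ∀ x →
                   youTotal (child (picked n) x ∷ rest n) < youTotal D
youMove-youTotal n isYou x = sumBy-replace youSize (pick fair _ n) {child (picked n) x} (begin-strict
  youSize (child (picked n) x) ≤⟨ youSize≤size (child (picked n) x) ⟩
  size (child (picked n) x)    <⟨ size-child _ (picked-nonElem n) x ⟩
  size (picked n)              ≡⟨ youSize-YouState {picked n} (picked-nonElem n , isYou) ⟨
  youSize (picked n)           ∎)
  where open ℕ.≤-Reasoning

Step-You : ∀ {D k D′ k′} → Step D k D′ k′ → Any YouState D → k′ ≡ k × youTotal D′ < youTotal D
Step-You (youMove n isYou x)   _   = refl , youMove-youTotal n isYou x
Step-You (play n isMe _ _)     you with () ← trans (sym (fair-You n you)) isMe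
Step-You (steer n isMe _ _ _)  you with () ← trans (sym (fair-You n you)) isMe
Step-You (skip noYou _)        you = ⊥-elim (noYou you)

Step-YouState : ∀ {D k D′ k′ s} → Step D k D′ k′ → s ∈ D → YouState s →
                (∃ λ x → child s x ∈ D′) ⊎ s ∈ D′
Step-YouState (youMove n _ x) s∈D _ with ∈-─-split (pick fair _ n) s∈D
... | inj₁ refl   = inj₁ (x , here refl)
... | inj₂ s∈rest = inj₂ (there s∈rest)
Step-YouState (play n isMe _ _)    s∈D you with () ← trans (sym (fair-You n (lose s∈D you))) isMe
Step-YouState (steer n isMe _ _ _) s∈D you with () ← trans (sym (fair-You n (lose s∈D you))) isMe
Step-YouState (skip noYou _)       s∈D you = ⊥-elim (noYou (lose s∈D you))

record Duplication (t : GState) (D D′ : DState) : Set where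
  field
    copied      : GState
    copied-∈    : copied ∈ D
    mult-copied : ∀ z → mult z D′ ≡ occurrence z copied + mult z D
    shrinking   : D′ ⊆ D
    growing     : D ⊆ D′
    copied-low  : (copied ≡ t × mult t D < 2) ⊎ key D copied < key D t

Step-aimed : ∀ {D k D′ k′} → Step D k D′ k′ → ¬ Any YouState D → target k ∈ D → MeState (target k) →
             k′ ≡ suc k ⊎ (k′ ≡ k × Duplication (target k) D D′)
Step-aimed (youMove n isYou _) noYou _ _ = ⊥-elim (noYou (lose (picked-∈ n) (picked-nonElem n , isYou)))
Step-aimed (play _ _ _ _) _ _ _ = inj₁ refl
Step-aimed (skip _ absent) _ present me = ⊥-elim (absent (present , me))
Step-aimed {D} {k} (steer n _ _ _ notReady) noYou present me = inj₂ (refl , record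
  { copied      = picked n
  ; copied-∈    = picked-∈ n
  ; mult-copied = λ z → cong (occurrence z (picked n) +_) (sym (mult-rest n z))
  ; shrinking   = duplicate-⊆ (pick fair D n)
  ; growing     = ∈-duplicate (pick fair D n)
  ; copied-low  = copied-low
  })
  where
  copied-low : (picked n ≡ target k × mult (target k) D < 2) ⊎ key D (picked n) < key D (target k)
  copied-low with picked n ≟ target k
  ... | yes p≡t = inj₁ (p≡t , ℕ.≰⇒> (notReady ∘ (p≡t ,_)))
  ... | no p≢t  = inj₂ (ℕ.≤∧≢⇒< (fair-least n noYou present (proj₁ me)) (p≢t ∘ key-injective {D} {D}))

Step-untargeted : ∀ {D k D′ k′} → Step D k D′ k′ → ¬ Any YouState D →
                  ¬ (target k ∈ D × MeState (target k)) → k′ ≡ suc k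
Step-untargeted (youMove n isYou _) noYou _ = ⊥-elim (noYou (lose (picked-∈ n) (picked-nonElem n , isYou)))
Step-untargeted (play _ _ _ _)          _ _      = refl
Step-untargeted (steer _ _ present me _) _ absent = ⊥-elim (absent (present , me))
Step-untargeted (skip _ _)              _ _      = refl

child-enumIx-cong : ∀ {a b} → a ≡ b → .(na : NonElem a) .(nb : NonElem b) (i : ℕ) →
                    child a (enumIx a na i) ≡ child b (enumIx b nb i)
child-enumIx-cong refl _ _ _ = refl

Step-increment : ∀ {D k D′ k′ s} → Step D k D′ k′ → k′ ≡ suc k → target k ≡ s → s ∈ D → (me : MeState s) →
                 child s (enumIx s (proj₁ me) (targetIx k)) ∈ D′
Step-increment (youMove _ _ _)   k≡1+k = ⊥-elim (ℕ.1+n≢n (sym k≡1+k))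
Step-increment (steer _ _ _ _ _) k≡1+k = ⊥-elim (ℕ.1+n≢n (sym k≡1+k))
Step-increment (play n _ p≡t _) _ t≡s _ me = here (child-enumIx-cong (sym (trans p≡t t≡s)) _ _ _)
Step-increment (skip _ absent) _ refl s∈D me = ⊥-elim (absent (s∈D , me))

-- Completeness

module Completeness (em : ExcludedMiddle 0ℓ) (em₁ : ExcludedMiddle (Level.suc 0ℓ)) where
  open Classical em
  open import Data.List.Membership.DecPropositional _≟_ using (_∈?_)

  Losing : DState → Set₁
  Losing D = ¬ DWin fair D

  -- A losing disjunctive state has a losing move of You, and all my moves lose.
  step : ∀ D k → Losing D → ∃₂ λ D′ k′ → Step D k D′ k′ × Losing D′
  step D k losing with Any.any? nonElem? D
  ... | no noneNon =
    D , suc k , skip (noneNon ∘ Any.map proj₁) (noneNon ∘ λ (t∈D , me) → lose t∈D (proj₁ me)) , losing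
  ... | yes n with owner (picked n) in isOwner
  ...   | You with em₁ {∃ λ x → Losing (child (picked n) x ∷ rest n)}
  ...     | yes (x , losing′) = _ , k , youMove n isOwner x , losing′
  ...     | no allWin = ⊥-elim (losing (stepY n isOwner λ x → em⇒dne em₁ λ losing′ → allWin (x , losing′)))
  step D k losing | yes n | Me with target k ∈? D ×-dec meState? (target k)
  ...     | no absent = D , suc k , skip noYou absent , losing
    where
    noYou : ¬ Any YouState D
    noYou you with () ← trans (sym (fair-You n you)) isOwner
  ...     | yes (present , me) with (picked n ≟ target k) ×-dec (2 ℕ.≤? mult (target k) D)
  ...       | yes (p≡t , two) = _ , suc k , play n isOwner p≡t two , losing ∘ stepI n isOwner _
  ...       | no notReady     = _ , k , steer n isOwner present me notReady , losing ∘ dupI n isOwner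

  module Path (D₀ : DState) (losing₀ : Losing D₀) where

    Config : Set₁
    Config = Σ DState λ D → ℕ × Losing D

    next : Config → Config
    next (D , k , losing) = let (D′ , k′ , _ , losing′) = step D k losing in D′ , k′ , losing′

    config : ℕ → Config
    config zero    = D₀ , 0 , losing₀
    config (suc τ) = next (config τ)

    position : ℕ → DState
    position τ = proj₁ (config τ)

    roundAt : ℕ → ℕ
    roundAt τ = proj₁ (proj₂ (config τ))

    losing : ∀ τ → Losing (position τ)
    losing τ = proj₂ (proj₂ (config τ))

    move : ∀ τ → Step (position τ) (roundAt τ) (position (suc τ)) (roundAt (suc τ))
    move τ = proj₁ (proj₂ (proj₂ (step (position τ) (roundAt τ) (losing τ))))

    Occurs : GState → Set
    Occurs s = ∃ λ τ → s ∈ position τ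

    roundAt≤ : ∀ τ → roundAt τ ≤ τ
    roundAt≤ zero    = z≤n
    roundAt≤ (suc τ) = ≤-trans (Step-counter (move τ)) (s≤s (roundAt≤ τ))

    persists : ∀ {s τ τ′} → τ ≤ τ′ → s ∈ position τ → Persistent s → s ∈ position τ′
    persists τ≤τ′ = go (ℕ.≤⇒≤′ τ≤τ′)
      where
      go : ∀ {s τ τ′} → τ ℕ.≤′ τ′ → s ∈ position τ → Persistent s → s ∈ position τ′
      go ℕ.≤′-refl                  s∈ _          = s∈
      go (ℕ.≤′-step {n = τ′} τ≤τ′) s∈ persistent =
        Step-persists (move τ′) (go τ≤τ′ s∈ persistent) persistent

    youFair : ∀ {s} → Occurs s → YouState s → ∃ λ x → Occurs (child s x)
    youFair {s} (τ , s∈) = go τ (<-wellFounded (youTotal (position τ))) s∈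
      where
      go : ∀ τ → Acc _<_ (youTotal (position τ)) → s ∈ position τ → YouState s →
           ∃ λ x → Occurs (child s x)
      go τ (acc smaller) s∈ you with Step-YouState (move τ) s∈ you
      ... | inj₁ (x , c∈) = x , suc τ , c∈
      ... | inj₂ s∈′      = go (suc τ) (smaller (proj₂ (Step-You (move τ) (lose s∈ you)))) s∈′ you

    Increment : ℕ → Set
    Increment τ = ∃ λ τ′ → roundAt τ′ ≡ roundAt τ × roundAt (suc τ′) ≡ suc (roundAt τ)

    increment-later : ∀ τ → roundAt (suc τ) ≡ roundAt τ → Increment (suc τ) → Increment τ
    increment-later τ same (τ′ , e₁ , e₂) = τ′ , trans e₁ same , trans e₂ (cong suc same)

    -- While I steer the regulation to t by duplication, every copied state has fewer than
    -- `bound` copies, so the measure decreases.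
    module Steering (t : GState) (me : MeState t) (c₀ : ℕ) (L₀ : DState) where

      bound : ℕ
      bound = pair (2 + c₀) (encode t)

      measure : DState → ℕ
      measure D = sumBy (λ y → bound ∸ mult y D) L₀

      module _ {D D′ : DState} (dup : Duplication t D D′) (bounded : mult t D ≤ 2 + c₀) where
        open Duplication dup

        copied<bound : mult copied D < bound
        copied<bound with copied-low
        ... | inj₁ (refl , few) = <-≤-trans few (≤-trans (m≤m+n 2 c₀) (m≤pair (2 + c₀) _))
        ... | inj₂ lower = begin-strict
          mult copied D   ≤⟨ m≤pair _ _ ⟩
          key D copied    <⟨ lower ⟩
          key D t         ≤⟨ pair-monoˡ-≤ (encode t) bounded ⟩
          bound           ∎
          where open ℕ.≤-Reasoning

        measure-decreases : D ⊆ L₀ → measure D′ < measure D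
        measure-decreases within = sumBy-mono-< pointwise (within copied-∈) strict
          where
          pointwise : ∀ y → bound ∸ mult y D′ ≤ bound ∸ mult y D
          pointwise y rewrite mult-copied y = ℕ.∸-monoʳ-≤ bound (m≤n+m (mult y D) (occurrence y copied))
          strict : bound ∸ mult copied D′ < bound ∸ mult copied D
          strict rewrite mult-copied copied | occurrence-self copied = ℕ.∸-monoʳ-< ≤-refl copied<bound

        bounded′ : mult t D′ ≤ 2 + c₀
        bounded′ rewrite mult-copied t with copied-low
        ... | inj₁ (refl , few) rewrite occurrence-self copied = ≤-trans few (m≤m+n 2 c₀)
        ... | inj₂ lower rewrite occurrence-≢ {t} {copied} (λ { refl → ℕ.<-irrefl refl lower }) = bounded

      record Invariant (τ : ℕ) : Set where
        field
          noYou   : ¬ Any YouState (position τ)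
          aimed   : target (roundAt τ) ≡ t
          present : t ∈ position τ
          bounded : mult t (position τ) ≤ 2 + c₀
          within  : position τ ⊆ L₀

      aimedStep : ∀ τ → Invariant τ → roundAt (suc τ) ≡ suc (roundAt τ)
                  ⊎ (roundAt (suc τ) ≡ roundAt τ × Duplication t (position τ) (position (suc τ)))
      aimedStep τ inv = Sum.map₂ (Product.map₂ (subst (λ u → Duplication u _ _) aimed))
        (Step-aimed (move τ) noYou (subst (_∈ position τ) (sym aimed) present) (subst MeState (sym aimed) me))
        where open Invariant inv

      steers : ∀ τ → Acc _<_ (measure (position τ)) → Invariant τ → Increment τ
      steers τ (acc smaller) inv with aimedStep τ inv
      ... | inj₁ incremented = τ , refl , incremented
      ... | inj₂ (same , dup) = increment-later τ same
            (steers (suc τ) (smaller (measure-decreases dup bounded within)) record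
              { noYou   = noYou ∘ Any-resp-⊆ shrinking
              ; aimed   = trans (cong target same) aimed
              ; present = growing present
              ; bounded = bounded′ dup bounded
              ; within  = within ∘ shrinking
              })
        where
        open Invariant inv
        open Duplication dup

    progress : ∀ τ → Increment τ
    progress τ = go τ (<-wellFounded _)
      where
      go : ∀ τ → Acc _<_ (youTotal (position τ)) → Increment τ
      go τ (acc smaller) with Any.any? youState? (position τ)
      ... | yes you = increment-later τ (proj₁ (Step-You (move τ) you))
                        (go (suc τ) (smaller (proj₂ (Step-You (move τ) you))))
      ... | no noYou with target (roundAt τ) ∈? position τ ×-dec meState? (target (roundAt τ))
      ...   | no absent          = τ , refl , Step-untargeted (move τ) noYou absent
      ...   | yes (present , me) =
              Steering.steers (target (roundAt τ)) me (mult (target (roundAt τ)) (position τ)) (position τ)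
                τ (<-wellFounded _)
                record { noYou = noYou ; aimed = refl ; present = present ; bounded = m≤n+m _ 2 ; within = id }

    incrementAt : ∀ m → ∃ λ τ → roundAt τ ≡ m × roundAt (suc τ) ≡ suc m
    incrementAt zero = progress 0
    incrementAt (suc m) with incrementAt m
    ... | τ , _ , reached with progress (suc τ)
    ... | τ′ , e₁ , e₂ = τ′ , trans e₁ reached , trans e₂ (cong suc reached)

    meFair : ∀ {s} → Occurs s → (me : MeState s) → ∀ x → Occurs (child s x)
    meFair {s} (τ , s∈) me x with enumIx-surjective s (proj₁ me) x
    ... | i , enum≡x with incrementAt (round s i τ)
    ... | τ′ , atRound , incremented = suc τ′ , subst (λ y → child s y ∈ position (suc τ′)) enum≡x played
      where
      aimed : target (roundAt τ′) ≡ s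
      aimed = trans (cong target atRound) (target-round s i τ)
      present : s ∈ position τ′
      present = persists (≤-trans (≤-round s i τ) (subst (_≤ τ′) atRound (roundAt≤ τ′))) s∈ (inj₂ me)
      played : child s (enumIx s (proj₁ me) i) ∈ position (suc τ′)
      played = subst (λ j → child s (enumIx s (proj₁ me) j) ∈ position (suc τ′))
                 (trans (cong targetIx atRound) (targetIx-round s i τ))
                 (Step-increment (move τ′) (trans incremented (cong suc (sym atRound))) aimed present me)

  -- The model read off my opponent's claims along a play that I do not win; every state
  -- occurring in the play is refuted in it.
  module Herbrand (D₀ : DState) (losing₀ : Losing D₀) where
    open Path D₀ losing₀

    data Equated (τ : ℕ) : Nom → Nom → Set where
      claimed  : ∀ {k i} → at 𝐎 i (nom k) ∈ position τ → Equated τ k i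
      eq-refl  : ∀ {a} → Equated τ a a
      eq-sym   : ∀ {a b} → Equated τ a b → Equated τ b a
      eq-trans : ∀ {a b c} → Equated τ a b → Equated τ b c → Equated τ a c

    Upward : (ℕ → Set) → Set
    Upward P = ∀ {τ τ′} → τ ≤ τ′ → P τ → P τ′

    ∈-upward : ∀ {s} → ElemS s → Upward (λ τ → s ∈ position τ)
    ∈-upward elem τ≤τ′ s∈ = persists τ≤τ′ s∈ (inj₁ elem)

    Equated-upward : ∀ {a b} → Upward (λ τ → Equated τ a b)
    Equated-upward τ≤τ′ (claimed c∈)   = claimed (∈-upward refl τ≤τ′ c∈)
    Equated-upward τ≤τ′ eq-refl        = eq-refl
    Equated-upward τ≤τ′ (eq-sym e)     = eq-sym (Equated-upward τ≤τ′ e)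
    Equated-upward τ≤τ′ (eq-trans e f) = eq-trans (Equated-upward τ≤τ′ e) (Equated-upward τ≤τ′ f)

    ×-upward : ∀ {P Q} → Upward P → Upward Q → Upward (λ τ → P τ × Q τ)
    ×-upward upP upQ τ≤τ′ (p , q) = upP τ≤τ′ p , upQ τ≤τ′ q

    together : ∀ {P Q} → Upward P → Upward Q → ∃ P → ∃ Q → ∃ λ τ → P τ × Q τ
    together upP upQ (τ , p) (τ′ , q) = τ ⊔ τ′ , upP (m≤m⊔n τ τ′) p , upQ (m≤n⊔m τ τ′) q

    _≈_ : Rel ℕ 0ℓ
    a ≈ b = ∃ λ τ → Equated τ a b

    ≈-isEquivalence : IsEquivalence _≈_
    ≈-isEquivalence = record
      { refl  = 0 , eq-refl
      ; sym   = λ (τ , e) → τ , eq-sym e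
      ; trans = λ e f → let (τ , e′ , f′) = together Equated-upward Equated-upward e f
                        in τ , eq-trans e′ f′
      }

    open TermModel _≈_ ≈-isEquivalence
      (λ k l → ∃ λ i → Occurs (at 𝐎 i (rel k l))) (λ p k → Occurs (at 𝐎 k (var p)))

    Equated-sound : ∀ {τ a b} → Equated τ a b → ∀ M → ElemWin M (position τ) ⊎ g M a ≡ g M b
    Equated-sound (claimed {k} {i} c∈) M with em {g M k ≡ g M i}
    ... | yes gk≡gi = inj₂ gk≡gi
    ... | no gk≢gi  = inj₁ (lose c∈ (refl , leafW refl gk≢gi))
    Equated-sound eq-refl        M = inj₂ refl
    Equated-sound (eq-sym e)     M = Sum.map₂ sym (Equated-sound e M)
    Equated-sound (eq-trans e f) M with Equated-sound e M | Equated-sound f M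
    ... | inj₁ won | _        = inj₁ won
    ... | inj₂ _   | inj₁ won = inj₁ won
    ... | inj₂ e′  | inj₂ f′  = inj₂ (trans e′ f′)

    clash : ∀ τ → ¬ ElemGameValid (position τ)
    clash τ = losing τ ∘ ElemGameValid⇒DWin fair (position τ)

    ⊭-elementary : ∀ Q i φ → isElemForm φ ≡ true → Occurs (at Q i φ) → model ⊭ at Q i φ
    ⊭-elementary 𝐎 i (var p)   _ occurs   = i , refl , occurs
    ⊭-elementary 𝐎 i (nom k)   _ (τ , c∈) = ≈⇒[≡] (τ , claimed c∈)
    ⊭-elementary 𝐎 i (rel k l) _ occurs   = k , l , refl , refl , i , occurs
    ⊭-elementary 𝐏 i (var p)   _ claim holds
      with k , k≈i , denial ← ⊨var⁻ holds
      with τ , claim′ , k≡i , denial′ ← together (∈-upward refl) (×-upward Equated-upward (∈-upward refl))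
                                          claim (together Equated-upward (∈-upward refl) k≈i denial)
      = clash τ λ M _ → [ id , decide M ]′ (Equated-sound k≡i M)
      where
      decide : ∀ M → g M k ≡ g M i → ElemWin M (position τ)
      decide M gk≡gi with em {V M p (g M i)}
      ... | yes v = lose claim′ (refl , leafW refl v)
      ... | no ¬v = lose denial′ (refl , leafW refl (¬v ∘ subst (V M p) gk≡gi))
    ⊭-elementary 𝐏 i (nom k)   _ claim holds
      with τ , claim′ , k≡i ← together (∈-upward refl) Equated-upward claim ([≡]⇒≈ holds)
      = clash τ λ M _ → [ id , (λ gk≡gi → lose claim′ (refl , leafW refl gk≡gi)) ]′ (Equated-sound k≡i M)
    ⊭-elementary 𝐏 i (rel k l) _ claim holds
      with k′ , l′ , k′≈k , l′≈l , i′ , denial ← ⊨rel⁻ holds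
      with τ , (claim′ , denial′) , (k′≡k , l′≡l) ←
             together (×-upward (∈-upward refl) (∈-upward refl)) (×-upward Equated-upward Equated-upward)
               (together (∈-upward refl) (∈-upward refl) claim denial)
               (together Equated-upward Equated-upward k′≈k l′≈l)
      = clash τ λ M _ →
          [ id , (λ gk′≡gk → [ id , decide M gk′≡gk ]′ (Equated-sound l′≡l M)) ]′ (Equated-sound k′≡k M)
      where
      decide : ∀ M → g M k′ ≡ g M k → g M l′ ≡ g M l → ElemWin M (position τ)
      decide M gk′≡gk gl′≡gl with em {R M (g M k) (g M l)}
      ... | yes r = lose claim′ (refl , leafW refl r)
      ... | no ¬r = lose denial′ (refl , leafW refl (¬r ∘ subst₂ (R M) gk′≡gk gl′≡gl))
    ⊭-elementary Q i (_ ∧' _)  () _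
    ⊭-elementary Q i (_ ∨' _)  () _
    ⊭-elementary Q i (_ ⇒' _)  () _
    ⊭-elementary Q i (¬' _)    () _
    ⊭-elementary Q i (at' _ _) () _
    ⊭-elementary Q i (□' _)    () _
    ⊭-elementary Q i (◇' _)    () _

    ⊭-occurs : ∀ s → Occurs s → model ⊭ s
    ⊭-occurs s = go s (<-wellFounded (size s))
      where
      go : ∀ s → Acc _<_ (size s) → Occurs s → model ⊭ s
      go s (acc smaller) occurs with elementary? s
      go (at Q i φ) _ occurs     | inj₁ elem    = ⊭-elementary Q i φ elem occurs
      go s (acc smaller) occurs | inj₂ nonElem = ascend (owner s) refl
        where
        below : ∀ x → Occurs (child s x) → model ⊭ child s x
        below x = go (child s x) (smaller (size-child s nonElem x))
        ascend : ∀ o → owner s ≡ o → model ⊭ s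
        ascend You isYou with x , occurs′ ← youFair occurs (nonElem , isYou) =
          subst (λ o → Ascend o model s) isYou (⊭-ascend model named s nonElem) x (below x occurs′)
        ascend Me isMe =
          subst (λ o → Ascend o model s) isMe (⊭-ascend model named s nonElem)
            λ x → below x (meFair occurs (nonElem , isMe) x)

  Valid⇒Winning : ∀ φ → Valid φ → Winning (glob 𝐏 φ ∷ [])
  Valid⇒Winning φ valid with em₁ {DWin fair (glob 𝐏 φ ∷ [])}
  ... | yes win = fair , win
  ... | no losing with w , fails ← Herbrand.⊭-occurs (glob 𝐏 φ ∷ []) losing (glob 𝐏 φ) (0 , here refl) =
    ⊥-elim (fails (valid _ w))

proposition1 : ExcludedMiddle 0ℓ → ExcludedMiddle (Level.suc 0ℓ) →
    ∀ (φ : Form) → Valid φ ⇔ Winning (glob 𝐏 φ ∷ [])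
proposition1 em em₁ φ = mk⇔ (Completeness.Valid⇒Winning em em₁ φ) (Soundness.Winning⇒Valid em φ)
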